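{- Let $q\ge2$, $n\ge1$ and let $\mathbf{a}=(A_0,\dots,A_n)$ be a quasicode of length $n$ over an alphabet of size $q$. Then $\mathbf{a}$ is a universally optimal quasicode if and only if its dual $\mathbf{a}^\perp$ is a universally optimal quasicode.
   Context: Krawtchouk polynomials: $K_k(x)=\sum_{j=0}^k(-1)^j(q-1)^{k-j}\binom{x}{j}\binom{n-x}{k-j}$. A quasicode of length $n$ and size $N$ is a real vector $\mathbf{a}=(A_0,\dots,A_n)$ with $A_0=1$, $A_i\ge 0$, $\sum_iA_i=N$, and $\sum_{i=0}^nA_iK_j(i)\ge0$ for $j=0,\dots,n$; write $|\mathbf{a}|=N$. Its dual is $\mathbf{a}^\perp=(A_0^\perp,\dots,A_n^\perp)$ with $A_j^\perp=\frac1N\sum_{i=0}^nA_iK_j(i)$ (this is again a quasicode, of size $q^n/N$). With $\Delta f(m)=f(m+1)-f(m)$, $f\colon\{0,\dots,n\}\to\mathbb{R}$ is completely monotonic if $(-1)^k\Delta^kf(i)\ge0$ whenever $k\ge0$, $0\le i\le n-k$. A quasicode $\mathbf{a}$ is universally optimal if for every completely monotonic $f\colon\{0,\dots,n\}\to\mathbb{R}$ and every quasicode $\mathbf{b}=(B_0,\dots,B_n)$ of the same length (same $q$) with $|\mathbf{b}|=|\mathbf{a}|$, one has $\sum_i f(i)A_i\le\sum_i f(i)B_i$. -}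

module Defs where

open import Level using (0ℓ)
open import Data.Nat using (ℕ; zero; suc; _∸_; _^_) renaming (_*_ to _*ℕ_; _≤_ to _≤ℕ_; _+_ to _+ℕ_)
open import Data.Nat.Combinatorics using (_C_)
open import Data.Product using (Σ; ∃; _×_; _,_)
open import Relation.Binary.PropositionalEquality using (_≡_)
open import Relation.Nullary using (¬_)
open import Algebra.Structures using (IsCommutativeRing)
open import Function.Bundles using (_⇔_)
open import Data.Sum using (_⊎_)

-- An axiomatic model of the real numbers: a Dedekind-complete ordered field
-- (equality is propositional equality on the carrier; the multiplicative
-- inverse is total, with x⁻¹ specified only for x ≠ 0).
record RealField : Set₁ where
  infixl 6 _+_ _-_
  infixl 7 _*_
  infix 4 _≤_
  field
    ℝ : Set
    _+_ _*_ : ℝ → ℝ → ℝ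
    -_ : ℝ → ℝ
    _⁻¹ : ℝ → ℝ
    0ℝ 1ℝ : ℝ
    _≤_ : ℝ → ℝ → Set
    isCommutativeRing : IsCommutativeRing _≡_ _+_ _*_ -_ 0ℝ 1ℝ
    0≢1 : ¬ (0ℝ ≡ 1ℝ)
    ⁻¹-inverse : ∀ x → ¬ (x ≡ 0ℝ) → x * (x ⁻¹) ≡ 1ℝ
    ≤-refl : ∀ x → x ≤ x
    ≤-trans : ∀ {x y z} → x ≤ y → y ≤ z → x ≤ z
    ≤-antisym : ∀ {x y} → x ≤ y → y ≤ x → x ≡ y
    ≤-total : ∀ x y → (x ≤ y) ⊎ (y ≤ x)
    +-mono-≤ : ∀ {x y} z → x ≤ y → x + z ≤ y + z
    *-nonneg : ∀ {x y} → 0ℝ ≤ x → 0ℝ ≤ y → 0ℝ ≤ x * y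
    sup : (P : ℝ → Set) → ∃ P → (∃ λ u → ∀ x → P x → x ≤ u) →
          ∃ λ s → (∀ x → P x → x ≤ s) × (∀ u → (∀ x → P x → x ≤ u) → s ≤ u)

  _-_ : ℝ → ℝ → ℝ
  x - y = x + (- y)

module Quasi (R : RealField) where
  open RealField R

  fromℕ : ℕ → ℝ
  fromℕ zero = 0ℝ
  fromℕ (suc m) = 1ℝ + fromℕ m

  negPow : ℕ → ℝ → ℝ
  negPow zero x = x
  negPow (suc k) x = - negPow k x

  sumTo : ℕ → (ℕ → ℝ) → ℝ
  sumTo zero g = g 0
  sumTo (suc n) g = sumTo n g + g (suc n)

  K : (q n k x : ℕ) → ℝ
  K q n k x = sumTo k (λ j → negPow j (fromℕ (((q ∸ 1) ^ (k ∸ j)) *ℕ (x C j) *ℕ ((n ∸ x) C (k ∸ j)))))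

  -- Vectors (A_0,…,A_n) are represented as functions ℕ → ℝ;
  -- only the values at 0,…,n are ever used.
  record IsQuasicode (q n : ℕ) (a : ℕ → ℝ) : Set where
    field
      a0≡1 : a 0 ≡ 1ℝ
      nonneg : ∀ i → i ≤ℕ n → 0ℝ ≤ a i
      dualNonneg : ∀ j → j ≤ℕ n → 0ℝ ≤ sumTo n (λ i → a i * K q n j i)

  size : (n : ℕ) → (ℕ → ℝ) → ℝ
  size n a = sumTo n a

  dual : (q n : ℕ) → (ℕ → ℝ) → (ℕ → ℝ)
  dual q n a j = (size n a ⁻¹) * sumTo n (λ i → a i * K q n j i)

  Δ : (ℕ → ℝ) → (ℕ → ℝ)
  Δ f m = f (suc m) - f m

  Δ^ : ℕ → (ℕ → ℝ) → (ℕ → ℝ)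
  Δ^ zero f = f
  Δ^ (suc k) f = Δ (Δ^ k f)

  CompletelyMonotonic : (n : ℕ) → (ℕ → ℝ) → Set
  CompletelyMonotonic n f = ∀ k i → i +ℕ k ≤ℕ n → 0ℝ ≤ negPow k (Δ^ k f i)

  UniversallyOptimal : (q n : ℕ) → (ℕ → ℝ) → Set
  UniversallyOptimal q n a =
    IsQuasicode q n a ×
    (∀ (f : ℕ → ℝ) → CompletelyMonotonic n f →
     ∀ (b : ℕ → ℝ) → IsQuasicode q n b → size n b ≡ size n a →
     sumTo n (λ i → f i * a i) ≤ sumTo n (λ i → f i * b i))

module Submission where

-- Write  S_k(x) = Σ_{i ≤ n} C(n-i,k) x_i  for the binomial moments of a vector x.
-- (1) Newton's formula expands every f on {0,…,n} as f(i) = Σ_k C(n-i,k) c_k(f)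
--     with c_k(f) = (-1)^k Δ^k f(n-k), hence  Σ_i f(i) x_i = Σ_k c_k(f) S_k(x).
--     For completely monotonic f every c_k(f) is ≥ 0, and each i ↦ C(n-i,k) is
--     itself completely monotonic; so a quasicode is universally optimal iff it
--     minimises every binomial moment among quasicodes of its size.
-- (2) The Krawtchouk identity  Σ_j C(n-j,n-k) K_j(i) = q^k C(n-i,k)  gives
--     S_{n-k}(T x) = q^k S_k(x) for the transform (T x)_j = Σ_i x_i K_j(i).  As
--     the moments determine a vector, applying this twice shows T (T x) = q^n x.
-- (3) Hence the dual of a quasicode of size N is a quasicode of size q^n/N, the
--     dual of the dual is the quasicode itself, and S_k(a^⊥) = N⁻¹ q^(n-k) S_{n-k}(a).
--     Moment-optimality therefore passes from a to a^⊥, and, applied to a^⊥,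
--     from a^⊥ back to a^⊥⊥ = a.

open import Defs
open import Level using (0ℓ)
open import Data.Nat using (ℕ; zero; suc; _≤_; _<_; _∸_; _^_; z≤n; s≤s; >-nonZero) renaming (_+_ to _+ℕ_; _*_ to _*ℕ_)
import Data.Nat.Properties as ℕP
open import Data.Nat.Combinatorics using (_C_; nCk+nC[k+1]≡[n+1]C[k+1]; k>n⇒nCk≡0; nCn≡1)
open import Data.Nat.Tactic.RingSolver using (solve-∀)
open import Data.Product using (_,_; proj₂)
open import Data.Sum using (inj₁; inj₂)
open import Data.Empty using (⊥-elim)
open import Data.Maybe using (nothing)
open import Function.Bundles using (_⇔_; mk⇔)
open import Relation.Nullary using (¬_; yes; no)
open import Relation.Binary.PropositionalEquality
open import Relation.Binary.Bundles using (Poset)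
import Relation.Binary.Reasoning.PartialOrder as PosetReasoning
open import Algebra.Bundles using (CommutativeRing)
open import Tactic.RingSolver.Core.AlmostCommutativeRing using (fromCommutativeRing)

module QuasicodeDuality (R : RealField) where
  open RealField R renaming (_≤_ to _≤ᵣ_; ≤-refl to ≤ᵣ-refl; ≤-trans to ≤ᵣ-trans; ≤-antisym to ≤ᵣ-antisym; ≤-total to ≤ᵣ-total)
  open Quasi R

  ℝ-commutativeRing : CommutativeRing 0ℓ 0ℓ
  ℝ-commutativeRing = record { isCommutativeRing = isCommutativeRing }

  open CommutativeRing ℝ-commutativeRing using (+-assoc; +-comm; +-identityˡ; +-identityʳ; -‿inverseˡ; -‿inverseʳ; *-assoc; *-comm; *-identityˡ; *-identityʳ; distribˡ; distribʳ; zeroˡ; zeroʳ)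
  open import Algebra.Properties.Ring (CommutativeRing.ring ℝ-commutativeRing) using (-‿involutive; -‿distribʳ-*; -0#≈0#; -1*x≈-x)
  open import Algebra.Properties.AbelianGroup (CommutativeRing.+-abelianGroup ℝ-commutativeRing) using (\\-leftDividesˡ; //-rightDividesˡ; //-rightDividesʳ; x∙y⁻¹≈ε⇒x≈y; ⁻¹-anti-homo-∙; ⁻¹-anti-homo‿-; ⁻¹-∙-comm)
  open import Tactic.RingSolver.NonReflective (fromCommutativeRing ℝ-commutativeRing (λ _ → nothing))

  ℝ-poset : Poset 0ℓ 0ℓ 0ℓ
  ℝ-poset = record
    { _≈_ = _≡_
    ; _≤_ = _≤ᵣ_
    ; isPartialOrder = record
      { isPreorder = record { isEquivalence = isEquivalence ; reflexive = λ { refl → ≤ᵣ-refl _ } ; trans = ≤ᵣ-trans }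
      ; antisym = ≤ᵣ-antisym
      }
    }

  open Poset ℝ-poset using (≤-respˡ-≈; ≤-respʳ-≈)
  module ≤ᵣ-Reasoning = PosetReasoning ℝ-poset

  neg-+ : ∀ x y → - (x + y) ≡ - x + - y
  neg-+ x y = sym (⁻¹-∙-comm x y)

  *-distribˡ-sub : ∀ c x y → c * (x - y) ≡ c * x - c * y
  *-distribˡ-sub c x y = trans (distribˡ c x (- y)) (cong (c * x +_) (sym (-‿distribʳ-* c y)))

  1+-distribʳ : ∀ c y → y + c * y ≡ (1ℝ + c) * y
  1+-distribʳ c y = trans (cong (_+ c * y) (sym (*-identityˡ y))) (sym (distribʳ y 1ℝ c))

  sumTo-cong : ∀ n {g h : ℕ → ℝ} → (∀ i → i ≤ n → g i ≡ h i) → sumTo n g ≡ sumTo n h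
  sumTo-cong zero eq = eq 0 z≤n
  sumTo-cong (suc n) eq = cong₂ _+_ (sumTo-cong n (λ i i≤n → eq i (ℕP.m≤n⇒m≤1+n i≤n))) (eq (suc n) ℕP.≤-refl)

  sumTo-+ : ∀ n (g h : ℕ → ℝ) → sumTo n (λ i → g i + h i) ≡ sumTo n g + sumTo n h
  sumTo-+ zero g h = refl
  sumTo-+ (suc n) g h = trans (cong (_+ (g (suc n) + h (suc n))) (sumTo-+ n g h))
     (solve 4 (λ a b c d → ((a ⊕ b) ⊕ (c ⊕ d)) ⊜ ((a ⊕ c) ⊕ (b ⊕ d))) refl (sumTo n g) (sumTo n h) (g (suc n)) (h (suc n)))

  sumTo-*ˡ : ∀ n c (g : ℕ → ℝ) → sumTo n (λ i → c * g i) ≡ c * sumTo n g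
  sumTo-*ˡ zero c g = refl
  sumTo-*ˡ (suc n) c g = trans (cong (_+ (c * g (suc n))) (sumTo-*ˡ n c g)) (sym (distribˡ c (sumTo n g) (g (suc n))))

  sumTo-*ʳ : ∀ n c (g : ℕ → ℝ) → sumTo n (λ i → g i * c) ≡ sumTo n g * c
  sumTo-*ʳ n c g = trans (sumTo-cong n (λ i _ → *-comm (g i) c)) (trans (sumTo-*ˡ n c g) (*-comm c (sumTo n g)))

  sumTo-neg : ∀ n (g : ℕ → ℝ) → sumTo n (λ i → - g i) ≡ - sumTo n g
  sumTo-neg zero g = refl
  sumTo-neg (suc n) g = trans (cong (_+ (- g (suc n))) (sumTo-neg n g)) (sym (neg-+ (sumTo n g) (g (suc n))))

  sumTo-zero : ∀ n {g : ℕ → ℝ} → (∀ i → i ≤ n → g i ≡ 0ℝ) → sumTo n g ≡ 0ℝ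
  sumTo-zero zero eq = eq 0 z≤n
  sumTo-zero (suc n) eq = trans (cong₂ _+_ (sumTo-zero n (λ i i≤n → eq i (ℕP.m≤n⇒m≤1+n i≤n))) (eq (suc n) ℕP.≤-refl)) (+-identityˡ 0ℝ)

  sumTo-peel : ∀ n (g : ℕ → ℝ) → sumTo (suc n) g ≡ g 0 + sumTo n (λ i → g (suc i))
  sumTo-peel zero g = refl
  sumTo-peel (suc n) g = trans (cong (_+ g (suc (suc n))) (sumTo-peel n g)) (+-assoc (g 0) _ _)

  sumTo-swap : ∀ n m (g : ℕ → ℕ → ℝ) → sumTo n (λ i → sumTo m (λ k → g i k)) ≡ sumTo m (λ k → sumTo n (λ i → g i k))
  sumTo-swap zero m g = refl
  sumTo-swap (suc n) m g = trans (cong (_+ sumTo m (g (suc n))) (sumTo-swap n m g)) (sym (sumTo-+ m (λ k → sumTo n (λ i → g i k)) (g (suc n))))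

  sumTo-vanishing-tail : ∀ a d (g : ℕ → ℝ) → (∀ k → a < k → k ≤ a +ℕ d → g k ≡ 0ℝ) → sumTo (a +ℕ d) g ≡ sumTo a g
  sumTo-vanishing-tail a zero g eq rewrite ℕP.+-identityʳ a = refl
  sumTo-vanishing-tail a (suc d) g eq rewrite ℕP.+-suc a d =
    trans (cong₂ _+_ (sumTo-vanishing-tail a d g (λ k a<k k≤ → eq k a<k (ℕP.m≤n⇒m≤1+n k≤)))
                     (eq (suc (a +ℕ d)) (s≤s (ℕP.m≤m+n a d)) ℕP.≤-refl))
          (+-identityʳ _)

  sumTo-single : ∀ n i (g : ℕ → ℝ) → i ≤ n → (∀ l → l ≤ n → ¬ (l ≡ i) → g l ≡ 0ℝ) → sumTo n g ≡ g i
  sumTo-single zero zero g _ eq = refl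
  sumTo-single (suc n) i g i≤ eq with i ℕP.≟ suc n
  ... | yes refl = trans (cong (_+ g (suc n)) (sumTo-zero n (λ l l≤n → eq l (ℕP.m≤n⇒m≤1+n l≤n) (λ e → ℕP.<-irrefl e (s≤s l≤n))))) (+-identityˡ _)
  ... | no ne = trans (cong₂ _+_ (sumTo-single n i g (ℕP.≤-pred (ℕP.≤∧≢⇒< i≤ ne)) (λ l l≤n → eq l (ℕP.m≤n⇒m≤1+n l≤n))) (eq (suc n) ℕP.≤-refl (λ e → ne (sym e)))) (+-identityʳ _)

  fromℕ-+ : ∀ a b → fromℕ (a +ℕ b) ≡ fromℕ a + fromℕ b
  fromℕ-+ zero b = sym (+-identityˡ _)
  fromℕ-+ (suc a) b = trans (cong (1ℝ +_) (fromℕ-+ a b)) (sym (+-assoc 1ℝ _ _))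

  fromℕ-* : ∀ a b → fromℕ (a *ℕ b) ≡ fromℕ a * fromℕ b
  fromℕ-* zero b = sym (zeroˡ _)
  fromℕ-* (suc a) b = begin
    fromℕ (b +ℕ a *ℕ b)              ≡⟨ fromℕ-+ b (a *ℕ b) ⟩
    fromℕ b + fromℕ (a *ℕ b)         ≡⟨ cong (fromℕ b +_) (fromℕ-* a b) ⟩
    fromℕ b + fromℕ a * fromℕ b      ≡⟨ 1+-distribʳ (fromℕ a) (fromℕ b) ⟩
    (1ℝ + fromℕ a) * fromℕ b         ∎
    where open ≡-Reasoning

  fromℕ-1 : fromℕ 1 ≡ 1ℝ
  fromℕ-1 = +-identityʳ 1ℝ

  fromℕ-pred : ∀ m → 1 ≤ m → fromℕ m ≡ 1ℝ + fromℕ (m ∸ 1)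
  fromℕ-pred (suc m) _ = refl

  negPow-+ : ∀ k x y → negPow k (x + y) ≡ negPow k x + negPow k y
  negPow-+ zero x y = refl
  negPow-+ (suc k) x y = trans (cong -_ (negPow-+ k x y)) (neg-+ _ _)

  negPow-*ˡ : ∀ k c x → negPow k (c * x) ≡ c * negPow k x
  negPow-*ˡ zero c x = refl
  negPow-*ˡ (suc k) c x = trans (cong -_ (negPow-*ˡ k c x)) (-‿distribʳ-* c _)

  negPow-0 : ∀ k → negPow k 0ℝ ≡ 0ℝ
  negPow-0 zero = refl
  negPow-0 (suc k) = trans (cong -_ (negPow-0 k)) -0#≈0#

  negPow-neg : ∀ k x → negPow k (- x) ≡ - negPow k x
  negPow-neg zero x = refl
  negPow-neg (suc k) x = cong -_ (negPow-neg k x)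

  negPow-involutive : ∀ k x → negPow k (negPow k x) ≡ x
  negPow-involutive zero x = refl
  negPow-involutive (suc k) x = trans (cong -_ (negPow-neg k (negPow k x))) (trans (-‿involutive _) (negPow-involutive k x))

  +-mono-≤₂ : ∀ {a b c d} → a ≤ᵣ b → c ≤ᵣ d → a + c ≤ᵣ b + d
  +-mono-≤₂ {b = b} {c} {d} a≤b c≤d = ≤ᵣ-trans (+-mono-≤ c a≤b) (≤-respˡ-≈ (+-comm c b) (≤-respʳ-≈ (+-comm d b) (+-mono-≤ b c≤d)))

  0≤-difference : ∀ {x y} → x ≤ᵣ y → 0ℝ ≤ᵣ y - x
  0≤-difference {x} {y} x≤y = ≤-respˡ-≈ (-‿inverseʳ x) (+-mono-≤ (- x) x≤y)

  -- If 1 ≤ 0 then 0 ≤ -1, so 0 ≤ (-1)(-1) = 1 anyway.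
  0≤1 : 0ℝ ≤ᵣ 1ℝ
  0≤1 with ≤ᵣ-total 0ℝ 1ℝ
  ... | inj₁ 0≤1 = 0≤1
  ... | inj₂ 1≤0 = ≤-respʳ-≈ (trans (-1*x≈-x (- 1ℝ)) (-‿involutive 1ℝ)) (*-nonneg 0≤-1 0≤-1)
    where
    0≤-1 : 0ℝ ≤ᵣ - 1ℝ
    0≤-1 = ≤-respʳ-≈ (+-identityˡ _) (0≤-difference 1≤0)

  1≤⇒0≤ : ∀ {x} → 1ℝ ≤ᵣ x → 0ℝ ≤ᵣ x
  1≤⇒0≤ = ≤ᵣ-trans 0≤1

  1≤⇒≢0 : ∀ {x} → 1ℝ ≤ᵣ x → ¬ (x ≡ 0ℝ)
  1≤⇒≢0 1≤x refl = 0≢1 (≤ᵣ-antisym 0≤1 1≤x)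

  1≤1+ : ∀ {x} → 0ℝ ≤ᵣ x → 1ℝ ≤ᵣ 1ℝ + x
  1≤1+ 0≤x = ≤-respˡ-≈ (+-identityʳ 1ℝ) (+-mono-≤₂ (≤ᵣ-refl 1ℝ) 0≤x)

  fromℕ-nonneg : ∀ m → 0ℝ ≤ᵣ fromℕ m
  fromℕ-nonneg zero = ≤ᵣ-refl 0ℝ
  fromℕ-nonneg (suc m) = 1≤⇒0≤ (1≤1+ (fromℕ-nonneg m))

  fromℕ-≢0 : ∀ m → 1 ≤ m → ¬ (fromℕ m ≡ 0ℝ)
  fromℕ-≢0 (suc m) _ = 1≤⇒≢0 (1≤1+ (fromℕ-nonneg m))

  *-monoˡ-≤ : ∀ {c x y} → 0ℝ ≤ᵣ c → x ≤ᵣ y → c * x ≤ᵣ c * y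
  *-monoˡ-≤ {c} {x} {y} 0≤c x≤y = ≤-respˡ-≈ (+-identityˡ (c * x)) (≤-respʳ-≈ shift (+-mono-≤ (c * x) 0≤c[y-x]))
    where
    0≤c[y-x] : 0ℝ ≤ᵣ c * (y - x)
    0≤c[y-x] = *-nonneg 0≤c (0≤-difference x≤y)
    shift : c * (y - x) + c * x ≡ c * y
    shift = trans (cong (_+ c * x) (*-distribˡ-sub c y x)) (//-rightDividesˡ (c * x) (c * y))

  ⁻¹-inverseˡ : ∀ c → ¬ (c ≡ 0ℝ) → c ⁻¹ * c ≡ 1ℝ
  ⁻¹-inverseˡ c c≢0 = trans (*-comm _ _) (⁻¹-inverse c c≢0)

  -- If c > 0 had c⁻¹ ≤ 0, then 0 ≤ c (-c⁻¹) = -1, i.e. 1 ≤ 0.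
  ⁻¹-nonneg : ∀ c → 0ℝ ≤ᵣ c → ¬ (c ≡ 0ℝ) → 0ℝ ≤ᵣ c ⁻¹
  ⁻¹-nonneg c 0≤c c≢0 with ≤ᵣ-total 0ℝ (c ⁻¹)
  ... | inj₁ 0≤c⁻¹ = 0≤c⁻¹
  ... | inj₂ c⁻¹≤0 = ⊥-elim (1≤⇒≢0 1≤0 refl)
    where
    0≤-1 : 0ℝ ≤ᵣ - 1ℝ
    0≤-1 = ≤-respʳ-≈ (trans (sym (-‿distribʳ-* c (c ⁻¹))) (cong -_ (⁻¹-inverse c c≢0)))
                     (*-nonneg 0≤c (≤-respʳ-≈ (+-identityˡ _) (0≤-difference c⁻¹≤0)))
    1≤0 : 1ℝ ≤ᵣ 0ℝ
    1≤0 = ≤-respˡ-≈ (+-identityˡ 1ℝ) (≤-respʳ-≈ (-‿inverseˡ 1ℝ) (+-mono-≤ 1ℝ 0≤-1))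

  *-≢0 : ∀ a b → ¬ (a ≡ 0ℝ) → ¬ (b ≡ 0ℝ) → ¬ (a * b ≡ 0ℝ)
  *-≢0 a b a≢0 b≢0 ab≡0 = b≢0 (begin
    b                  ≡⟨ sym (*-identityˡ b) ⟩
    1ℝ * b             ≡⟨ cong (_* b) (sym (⁻¹-inverseˡ a a≢0)) ⟩
    (a ⁻¹ * a) * b     ≡⟨ *-assoc _ _ _ ⟩
    a ⁻¹ * (a * b)     ≡⟨ cong (a ⁻¹ *_) ab≡0 ⟩
    a ⁻¹ * 0ℝ          ≡⟨ zeroʳ _ ⟩
    0ℝ                 ∎)
    where open ≡-Reasoning

  ⁻¹-≢0 : ∀ c → ¬ (c ≡ 0ℝ) → ¬ (c ⁻¹ ≡ 0ℝ)
  ⁻¹-≢0 c c≢0 c⁻¹≡0 = 0≢1 (trans (sym (zeroʳ c)) (trans (cong (c *_) (sym c⁻¹≡0)) (⁻¹-inverse c c≢0)))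

  ⁻¹-cancelˡ : ∀ c x → ¬ (c ≡ 0ℝ) → c ⁻¹ * (c * x) ≡ x
  ⁻¹-cancelˡ c x c≢0 = trans (sym (*-assoc _ _ _)) (trans (cong (_* x) (⁻¹-inverseˡ c c≢0)) (*-identityˡ x))

  sumTo-mono : ∀ n {g h : ℕ → ℝ} → (∀ i → i ≤ n → g i ≤ᵣ h i) → sumTo n g ≤ᵣ sumTo n h
  sumTo-mono zero p = p 0 z≤n
  sumTo-mono (suc n) p = +-mono-≤₂ (sumTo-mono n (λ i i≤n → p i (ℕP.m≤n⇒m≤1+n i≤n))) (p (suc n) ℕP.≤-refl)

  sumTo-nonneg : ∀ n {g : ℕ → ℝ} → (∀ i → i ≤ n → 0ℝ ≤ᵣ g i) → 0ℝ ≤ᵣ sumTo n g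
  sumTo-nonneg n p = ≤-respˡ-≈ (sumTo-zero n (λ _ _ → refl)) (sumTo-mono n p)

  1≤sumTo : ∀ n {b : ℕ → ℝ} → b 0 ≡ 1ℝ → (∀ i → i ≤ n → 0ℝ ≤ᵣ b i) → 1ℝ ≤ᵣ sumTo n b
  1≤sumTo zero b0≡1 _ = ≤-respʳ-≈ (sym b0≡1) (≤ᵣ-refl 1ℝ)
  1≤sumTo (suc n) {b} b0≡1 0≤b = ≤-respʳ-≈ (sym (trans (sumTo-peel n b) (cong (_+ sumTo n (λ i → b (suc i))) b0≡1)))
                                          (1≤1+ (sumTo-nonneg n (λ i i≤n → 0≤b (suc i) (s≤s i≤n))))

  Δ^-Δ : ∀ k (f : ℕ → ℝ) i → Δ^ k (Δ f) i ≡ Δ^ (suc k) f i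
  Δ^-Δ zero f i = refl
  Δ^-Δ (suc k) f i = cong₂ _-_ (Δ^-Δ k f (suc i)) (Δ^-Δ k f i)

  Δ^-+ : ∀ a b (f : ℕ → ℝ) i → Δ^ (a +ℕ b) f i ≡ Δ^ a (Δ^ b f) i
  Δ^-+ zero b f i = refl
  Δ^-+ (suc a) b f i = cong₂ _-_ (Δ^-+ a b f (suc i)) (Δ^-+ a b f i)

  Δ^-vanish : ∀ s (g : ℕ → ℝ) M → (∀ j → j ≤ M → g j ≡ 0ℝ) → ∀ i → i +ℕ s ≤ M → Δ^ s g i ≡ 0ℝ
  Δ^-vanish zero g M g≡0 i i≤M = g≡0 i (ℕP.≤-trans (ℕP.m≤m+n i 0) i≤M)
  Δ^-vanish (suc s) g M g≡0 i i+s+1≤M =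
    trans (cong₂ _-_ (Δ^-vanish s g M g≡0 (suc i) (ℕP.≤-trans (ℕP.≤-reflexive (sym (ℕP.+-suc i s))) i+s+1≤M))
                     (Δ^-vanish s g M g≡0 i (ℕP.≤-trans (ℕP.+-monoʳ-≤ i (ℕP.n≤1+n s)) i+s+1≤M)))
          (-‿inverseʳ 0ℝ)

  newton : ∀ r (f : ℕ → ℝ) m → sumTo r (λ k → fromℕ (r C k) * negPow k (Δ^ k f ((r +ℕ m) ∸ k))) ≡ f m
  newton zero f m = trans (cong (_* f m) fromℕ-1) (*-identityˡ _)
  newton (suc r) f m = begin
      sumTo (suc r) (λ k → fromℕ (suc r C k) * negPow k (Δ^ k f ((suc r +ℕ m) ∸ k)))
    ≡⟨ sumTo-peel r _ ⟩
      T₀ + sumTo r (λ s → fromℕ (suc r C suc s) * E s)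
    ≡⟨ cong (T₀ +_) (trans (sumTo-cong r (λ s _ → pascal s)) (sumTo-+ r _ _)) ⟩
      T₀ + (sumTo r (λ s → fromℕ (r C s) * E s) + sumTo r (λ s → fromℕ (r C suc s) * E s))
    ≡⟨ solve 3 (λ a b c → (a ⊕ (b ⊕ c)) ⊜ ((a ⊕ c) ⊕ b)) refl T₀ _ _ ⟩
      (T₀ + sumTo r (λ s → fromℕ (r C suc s) * E s)) + sumTo r (λ s → fromℕ (r C s) * E s)
    ≡⟨ cong₂ _+_ value-at-suc minus-difference ⟩
      f (suc m) + - Δ f m
    ≡⟨ trans (cong (f (suc m) +_) (⁻¹-anti-homo‿- (f (suc m)) (f m))) (trans (+-comm _ _) (//-rightDividesˡ (f (suc m)) (f m))) ⟩
      f m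
    ∎
    where
    open ≡-Reasoning
    E : ℕ → ℝ
    E s = negPow (suc s) (Δ^ (suc s) f ((r +ℕ m) ∸ s))
    T₀ : ℝ
    T₀ = fromℕ (suc r C 0) * negPow 0 (Δ^ 0 f (suc r +ℕ m))
    pascal : ∀ s → fromℕ (suc r C suc s) * E s ≡ fromℕ (r C s) * E s + fromℕ (r C suc s) * E s
    pascal s = trans (cong (λ e → fromℕ e * E s) (sym (nCk+nC[k+1]≡[n+1]C[k+1] r s)))
                     (trans (cong (_* E s) (fromℕ-+ (r C s) (r C suc s))) (distribʳ _ _ _))
    g : ℕ → ℝ
    g k = fromℕ (r C k) * negPow k (Δ^ k f ((suc r +ℕ m) ∸ k))
    -- Pascal's upper half is Newton's formula for r at m + 1 ...
    value-at-suc : T₀ + sumTo r (λ s → fromℕ (r C suc s) * E s) ≡ f (suc m)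
    value-at-suc = begin
        T₀ + sumTo r (λ s → fromℕ (r C suc s) * E s)
      ≡⟨ sym (sumTo-peel r g) ⟩
        sumTo r g + g (suc r)
      ≡⟨ cong (sumTo r g +_) (trans (cong (λ e → fromℕ e * negPow (suc r) (Δ^ (suc r) f ((suc r +ℕ m) ∸ suc r))) (k>n⇒nCk≡0 (ℕP.n<1+n r))) (zeroˡ _)) ⟩
        sumTo r g + 0ℝ
      ≡⟨ +-identityʳ _ ⟩
        sumTo r g
      ≡⟨ sumTo-cong r (λ k _ → cong (λ e → fromℕ (r C k) * negPow k (Δ^ k f (e ∸ k))) (sym (ℕP.+-suc r m))) ⟩
        sumTo r (λ k → fromℕ (r C k) * negPow k (Δ^ k f ((r +ℕ suc m) ∸ k)))
      ≡⟨ newton r f (suc m) ⟩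
        f (suc m)
      ∎
    -- ... and the lower half is minus Newton's formula for Δ f at m.
    minus-difference : sumTo r (λ s → fromℕ (r C s) * E s) ≡ - Δ f m
    minus-difference = begin
        sumTo r (λ s → fromℕ (r C s) * E s)
      ≡⟨ sumTo-cong r (λ s _ → trans (cong (λ z → fromℕ (r C s) * - negPow s z) (sym (Δ^-Δ s f ((r +ℕ m) ∸ s)))) (sym (-‿distribʳ-* _ _))) ⟩
        sumTo r (λ s → - (fromℕ (r C s) * negPow s (Δ^ s (Δ f) ((r +ℕ m) ∸ s))))
      ≡⟨ sumTo-neg r _ ⟩
        - sumTo r (λ s → fromℕ (r C s) * negPow s (Δ^ s (Δ f) ((r +ℕ m) ∸ s)))
      ≡⟨ cong -_ (newton r (Δ f) m) ⟩
        - Δ f m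
      ∎

  binom : ℕ → ℕ → ℕ → ℝ
  binom n k i = fromℕ ((n ∸ i) C k)

  moment : ℕ → ℕ → (ℕ → ℝ) → ℝ
  moment n k x = sumTo n (λ i → binom n k i * x i)

  newtonCoeff : ℕ → (ℕ → ℝ) → ℕ → ℝ
  newtonCoeff n f k = negPow k (Δ^ k f (n ∸ k))

  binom-expansion : ∀ n (f : ℕ → ℝ) i → i ≤ n → f i ≡ sumTo n (λ k → binom n k i * newtonCoeff n f k)
  binom-expansion n f i i≤n = begin
      f i
    ≡⟨ sym (newton (n ∸ i) f i) ⟩
      sumTo (n ∸ i) (λ k → fromℕ ((n ∸ i) C k) * negPow k (Δ^ k f (((n ∸ i) +ℕ i) ∸ k)))
    ≡⟨ sumTo-cong (n ∸ i) (λ k _ → cong (λ e → fromℕ ((n ∸ i) C k) * negPow k (Δ^ k f (e ∸ k))) (ℕP.m∸n+n≡m i≤n)) ⟩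
      sumTo (n ∸ i) term
    ≡⟨ sym (sumTo-vanishing-tail (n ∸ i) i term (λ k lt _ → trans (cong (λ e → fromℕ e * newtonCoeff n f k) (k>n⇒nCk≡0 lt)) (zeroˡ _))) ⟩
      sumTo ((n ∸ i) +ℕ i) term
    ≡⟨ cong (λ e → sumTo e term) (ℕP.m∸n+n≡m i≤n) ⟩
      sumTo n term
    ∎
    where
    open ≡-Reasoning
    term : ℕ → ℝ
    term k = binom n k i * newtonCoeff n f k

  pairing-via-moments : ∀ n (f x : ℕ → ℝ) → sumTo n (λ i → f i * x i) ≡ sumTo n (λ k → newtonCoeff n f k * moment n k x)
  pairing-via-moments n f x = begin
      sumTo n (λ i → f i * x i)
    ≡⟨ sumTo-cong n (λ i i≤n → trans (cong (_* x i) (binom-expansion n f i i≤n)) (sym (sumTo-*ʳ n (x i) _))) ⟩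
      sumTo n (λ i → sumTo n (λ k → binom n k i * newtonCoeff n f k * x i))
    ≡⟨ sumTo-cong n (λ i _ → sumTo-cong n (λ k _ → trans (cong (_* x i) (*-comm _ _)) (*-assoc _ _ _))) ⟩
      sumTo n (λ i → sumTo n (λ k → newtonCoeff n f k * (binom n k i * x i)))
    ≡⟨ sumTo-swap n n _ ⟩
      sumTo n (λ k → sumTo n (λ i → newtonCoeff n f k * (binom n k i * x i)))
    ≡⟨ sumTo-cong n (λ k _ → sumTo-*ˡ n (newtonCoeff n f k) _) ⟩
      sumTo n (λ k → newtonCoeff n f k * moment n k x)
    ∎
    where open ≡-Reasoning

  Δ-binom : ∀ n k j → suc j ≤ n → binom n (suc k) (suc j) - binom n (suc k) j ≡ - binom n k (suc j)
  Δ-binom n k j j<n = begin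
      a - fromℕ ((n ∸ j) C suc k)
    ≡⟨ cong (λ e → a - fromℕ (e C suc k)) (ℕP.+-∸-assoc 1 j<n) ⟩
      a - fromℕ (suc (n ∸ suc j) C suc k)
    ≡⟨ cong (λ e → a - fromℕ e) (sym (nCk+nC[k+1]≡[n+1]C[k+1] (n ∸ suc j) k)) ⟩
      a - fromℕ ((n ∸ suc j) C k +ℕ (n ∸ suc j) C suc k)
    ≡⟨ cong (λ z → a - z) (fromℕ-+ ((n ∸ suc j) C k) ((n ∸ suc j) C suc k)) ⟩
      a - (binom n k (suc j) + a)
    ≡⟨ trans (cong (a +_) (⁻¹-anti-homo-∙ (binom n k (suc j)) a)) (\\-leftDividesˡ a (- binom n k (suc j))) ⟩
      - binom n k (suc j)
    ∎
    where
    open ≡-Reasoning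
    a = binom n (suc k) (suc j)

  Δ^-binom : ∀ n t k i → i +ℕ t ≤ n → Δ^ t (binom n (t +ℕ k)) i ≡ negPow t (binom n k (i +ℕ t))
  Δ^-binom n zero k i _ = cong (binom n k) (sym (ℕP.+-identityʳ i))
  Δ^-binom n (suc t) k i i+t+1≤n = begin
      Δ^ t (binom n (suc t +ℕ k)) (suc i) - Δ^ t (binom n (suc t +ℕ k)) i
    ≡⟨ cong (λ e → Δ^ t (binom n e) (suc i) - Δ^ t (binom n e) i) (sym (ℕP.+-suc t k)) ⟩
      Δ^ t (binom n (t +ℕ suc k)) (suc i) - Δ^ t (binom n (t +ℕ suc k)) i
    ≡⟨ cong₂ _-_ (Δ^-binom n t (suc k) (suc i) i+1+t≤n) (Δ^-binom n t (suc k) i (ℕP.≤-trans (ℕP.n≤1+n _) i+1+t≤n)) ⟩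
      negPow t (binom n (suc k) (suc (i +ℕ t))) - negPow t (binom n (suc k) (i +ℕ t))
    ≡⟨ cong (negPow t (binom n (suc k) (suc (i +ℕ t))) +_) (sym (negPow-neg t _)) ⟩
      negPow t (binom n (suc k) (suc (i +ℕ t))) + negPow t (- binom n (suc k) (i +ℕ t))
    ≡⟨ sym (negPow-+ t _ _) ⟩
      negPow t (binom n (suc k) (suc (i +ℕ t)) - binom n (suc k) (i +ℕ t))
    ≡⟨ cong (negPow t) (Δ-binom n k (i +ℕ t) i+1+t≤n) ⟩
      negPow t (- binom n k (suc (i +ℕ t)))
    ≡⟨ negPow-neg t _ ⟩
      - negPow t (binom n k (suc (i +ℕ t)))
    ≡⟨ cong (λ e → - negPow t (binom n k e)) (sym (ℕP.+-suc i t)) ⟩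
      negPow (suc t) (binom n k (i +ℕ suc t))
    ∎
    where
    open ≡-Reasoning
    i+1+t≤n : suc i +ℕ t ≤ n
    i+1+t≤n = ℕP.≤-trans (ℕP.≤-reflexive (sym (ℕP.+-suc i t))) i+t+1≤n

  Δ^-binom-high : ∀ n k t i → k < t → i +ℕ t ≤ n → Δ^ t (binom n k) i ≡ 0ℝ
  Δ^-binom-high n k t i k<t i+t≤n = begin
      Δ^ t (binom n k) i
    ≡⟨ cong (λ e → Δ^ e (binom n k) i) (sym (ℕP.m∸n+n≡m k<t)) ⟩
      Δ^ (s +ℕ suc k) (binom n k) i
    ≡⟨ Δ^-+ s (suc k) (binom n k) i ⟩
      Δ^ s (Δ^ (suc k) (binom n k)) i
    ≡⟨ Δ^-vanish s _ M top-difference-zero i i+s≤M ⟩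
      0ℝ
    ∎
    where
    open ≡-Reasoning
    s = t ∸ suc k
    M = n ∸ suc k
    k<n : suc k ≤ n
    k<n = ℕP.≤-trans k<t (ℕP.m+n≤o⇒n≤o i i+t≤n)
    -- Δ^{k+1} C(n-·,k) = Δ ((-1)^k C(n-·-k, 0)) = Δ (constant) = 0.
    top-difference-zero : ∀ j → j ≤ M → Δ^ (suc k) (binom n k) j ≡ 0ℝ
    top-difference-zero j j≤M =
      trans (cong (λ e → Δ^ k (binom n e) (suc j) - Δ^ k (binom n e) j) (sym (ℕP.+-identityʳ k)))
            (trans (cong₂ _-_ (Δ^-binom n k 0 (suc j) j+1+k≤n) (Δ^-binom n k 0 j (ℕP.≤-trans (ℕP.n≤1+n _) j+1+k≤n))) (-‿inverseʳ _))
      where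
      j+1+k≤n : suc j +ℕ k ≤ n
      j+1+k≤n = ℕP.≤-trans (ℕP.≤-reflexive (sym (ℕP.+-suc j k))) (ℕP.m≤o∸n⇒m+n≤o j k<n j≤M)
    i+s≤M : i +ℕ s ≤ M
    i+s≤M = ℕP.m+n≤o⇒m≤o∸n (i +ℕ s) (ℕP.≤-trans (ℕP.≤-reflexive (trans (ℕP.+-assoc i s (suc k)) (cong (i +ℕ_) (ℕP.m∸n+n≡m k<t)))) i+t≤n)

  binom-completelyMonotonic : ∀ n k → CompletelyMonotonic n (binom n k)
  binom-completelyMonotonic n k t i i+t≤n with t ℕP.≤? k
  ... | yes t≤k = ≤-respʳ-≈ (sym low-order) (fromℕ-nonneg ((n ∸ (i +ℕ t)) C (k ∸ t)))
    where
    low-order : negPow t (Δ^ t (binom n k) i) ≡ binom n (k ∸ t) (i +ℕ t)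
    low-order = trans (cong (λ e → negPow t (Δ^ t (binom n e) i)) (sym (ℕP.m+[n∸m]≡n t≤k)))
                      (trans (cong (negPow t) (Δ^-binom n t (k ∸ t) i i+t≤n)) (negPow-involutive t _))
  ... | no t≰k = ≤-respʳ-≈ (sym (trans (cong (negPow t) (Δ^-binom-high n k t i (ℕP.≰⇒> t≰k) i+t≤n)) (negPow-0 t))) (≤ᵣ-refl 0ℝ)

  moment-*ˡ : ∀ n k c (x : ℕ → ℝ) → moment n k (λ i → c * x i) ≡ c * moment n k x
  moment-*ˡ n k c x = trans (sumTo-cong n (λ i _ → solve 3 (λ b c y → (b ⊗ (c ⊗ y)) ⊜ (c ⊗ (b ⊗ y))) refl _ c (x i))) (sumTo-*ˡ n c _)

  -- Moments determine a vector: if S_m(d) = 0 for all m ≤ n then d vanishes on [0, n].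
  -- Induction on i, since S_{n-i}(d) = d_i + Σ_{l < i} C(n-l, n-i) d_l.
  moments-zero : ∀ n (d : ℕ → ℝ) → (∀ m → m ≤ n → moment n m d ≡ 0ℝ) → ∀ b i → i < b → i ≤ n → d i ≡ 0ℝ
  moments-zero n d S≡0 (suc b) i (s≤s i≤b) i≤n with i ℕP.≟ b
  ... | no i≢b = moments-zero n d S≡0 b i (ℕP.≤∧≢⇒< i≤b i≢b) i≤n
  ... | yes refl = begin
      d i                               ≡⟨ sym (*-identityˡ (d i)) ⟩
      1ℝ * d i                          ≡⟨ cong (_* d i) (trans (sym fromℕ-1) (cong fromℕ (sym (nCn≡1 (n ∸ i))))) ⟩
      binom n (n ∸ i) i * d i           ≡⟨ sym (sumTo-single n i _ i≤n others-zero) ⟩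
      moment n (n ∸ i) d                ≡⟨ S≡0 (n ∸ i) (ℕP.m∸n≤m n i) ⟩
      0ℝ                                ∎
    where
    open ≡-Reasoning
    others-zero : ∀ l → l ≤ n → ¬ (l ≡ i) → binom n (n ∸ i) l * d l ≡ 0ℝ
    others-zero l l≤n l≢i with l ℕP.<? i
    ... | yes l<i = trans (cong (binom n (n ∸ i) l *_) (moments-zero n d S≡0 i l l<i l≤n)) (zeroʳ _)
    ... | no l≮i = trans (cong (λ e → fromℕ e * d l) (k>n⇒nCk≡0 (ℕP.∸-monoʳ-< (ℕP.≤∧≢⇒< (ℕP.≮⇒≥ l≮i) (λ e → l≢i (sym e))) l≤n))) (zeroˡ _)

  moments-determine : ∀ n (u v : ℕ → ℝ) → (∀ m → m ≤ n → moment n m u ≡ moment n m v) → ∀ i → i ≤ n → u i ≡ v i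
  moments-determine n u v S≡ i i≤n = x∙y⁻¹≈ε⇒x≈y (u i) (v i) (moments-zero n (λ i → u i - v i) S-difference (suc i) i ℕP.≤-refl i≤n)
    where
    S-difference : ∀ m → m ≤ n → moment n m (λ i → u i - v i) ≡ 0ℝ
    S-difference m m≤n = begin
        moment n m (λ i → u i - v i)
      ≡⟨ sumTo-cong n (λ i _ → *-distribˡ-sub _ (u i) (v i)) ⟩
        sumTo n (λ i → binom n m i * u i - binom n m i * v i)
      ≡⟨ trans (sumTo-+ n _ _) (cong (_ +_) (sumTo-neg n _)) ⟩
        moment n m u - moment n m v
      ≡⟨ cong (_- moment n m v) (S≡ m m≤n) ⟩
        moment n m v - moment n m v
      ≡⟨ -‿inverseʳ _ ⟩
        0ℝ
      ∎
      where open ≡-Reasoning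

  moment-0 : ∀ n (x : ℕ → ℝ) → moment n 0 x ≡ sumTo n x
  moment-0 n x = sumTo-cong n (λ i _ → trans (cong (_* x i) fromℕ-1) (*-identityˡ _))

  moment-top : ∀ n (x : ℕ → ℝ) → moment n n x ≡ x 0
  moment-top n x = begin
      moment n n x             ≡⟨ sumTo-single n 0 _ z≤n others-zero ⟩
      fromℕ (n C n) * x 0      ≡⟨ cong (λ e → fromℕ e * x 0) (nCn≡1 n) ⟩
      fromℕ 1 * x 0            ≡⟨ trans (cong (_* x 0) fromℕ-1) (*-identityˡ _) ⟩
      x 0                      ∎
    where
    open ≡-Reasoning
    others-zero : ∀ l → l ≤ n → ¬ (l ≡ 0) → binom n n l * x l ≡ 0ℝ
    others-zero zero _ l≢0 = ⊥-elim (l≢0 refl)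
    others-zero (suc l) l<n _ = trans (cong (λ e → fromℕ e * x (suc l)) (k>n⇒nCk≡0 (ℕP.∸-monoʳ-< (s≤s z≤n) l<n))) (zeroˡ _)

  module Krawtchouk (q : ℕ) where

    -- K_k(i) = Σ_t term r i k t  with  term r i k t = (-1)^t (q-1)^(k-t) C(i,t) C(r,k-t),  r = n - i.
    term : ℕ → ℕ → ℕ → ℕ → ℝ
    term r i k t = negPow t (fromℕ ((q ∸ 1) ^ (k ∸ t) *ℕ (i C t) *ℕ (r C (k ∸ t))))

    term-pascal-r : ∀ r i j t → t ≤ j → term (suc r) i (suc j) t ≡ term r i (suc j) t + fromℕ (q ∸ 1) * term r i j t
    term-pascal-r r i j t t≤j = begin
        term (suc r) i (suc j) t
      ≡⟨ cong (λ e → negPow t (fromℕ (Q ^ e *ℕ (i C t) *ℕ (suc r C e)))) (ℕP.+-∸-assoc 1 t≤j) ⟩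
        negPow t (fromℕ (Q *ℕ Q ^ s *ℕ (i C t) *ℕ (suc r C suc s)))
      ≡⟨ cong (λ e → negPow t (fromℕ e)) (trans (cong (λ c → Q *ℕ Q ^ s *ℕ (i C t) *ℕ c) (sym (nCk+nC[k+1]≡[n+1]C[k+1] r s)))
                                                (distribute Q (Q ^ s) (i C t) (r C s) (r C suc s))) ⟩
        negPow t (fromℕ (Q *ℕ Q ^ s *ℕ (i C t) *ℕ (r C suc s) +ℕ Q *ℕ (Q ^ s *ℕ (i C t) *ℕ (r C s))))
      ≡⟨ cong (negPow t) (trans (fromℕ-+ A (Q *ℕ B)) (cong (fromℕ A +_) (fromℕ-* Q B))) ⟩
        negPow t (fromℕ A + fromℕ Q * fromℕ B)
      ≡⟨ trans (negPow-+ t (fromℕ A) (fromℕ Q * fromℕ B)) (cong (negPow t (fromℕ A) +_) (negPow-*ˡ t (fromℕ Q) (fromℕ B))) ⟩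
        negPow t (fromℕ (Q *ℕ Q ^ s *ℕ (i C t) *ℕ (r C suc s))) + fromℕ Q * term r i j t
      ≡⟨ cong (λ e → negPow t (fromℕ (Q ^ e *ℕ (i C t) *ℕ (r C e))) + fromℕ Q * term r i j t) (sym (ℕP.+-∸-assoc 1 t≤j)) ⟩
        term r i (suc j) t + fromℕ Q * term r i j t
      ∎
      where
      open ≡-Reasoning
      Q = q ∸ 1
      s = j ∸ t
      A = Q *ℕ Q ^ s *ℕ (i C t) *ℕ (r C suc s)
      B = Q ^ s *ℕ (i C t) *ℕ (r C s)
      distribute : ∀ Q P a b c → Q *ℕ P *ℕ a *ℕ (b +ℕ c) ≡ Q *ℕ P *ℕ a *ℕ c +ℕ Q *ℕ (P *ℕ a *ℕ b)
      distribute = solve-∀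

    term-pascal-i : ∀ r i j s → term r (suc i) (suc j) (suc s) ≡ - term r i j s + term r i (suc j) (suc s)
    term-pascal-i r i j s = begin
        - negPow s (fromℕ (P *ℕ (suc i C suc s) *ℕ c))
      ≡⟨ cong (λ e → - negPow s (fromℕ e)) (trans (cong (λ b → P *ℕ b *ℕ c) (sym (nCk+nC[k+1]≡[n+1]C[k+1] i s)))
                                                   (distribute P (i C s) (i C suc s) c)) ⟩
        - negPow s (fromℕ (P *ℕ (i C s) *ℕ c +ℕ P *ℕ (i C suc s) *ℕ c))
      ≡⟨ cong (λ z → - negPow s z) (fromℕ-+ (P *ℕ (i C s) *ℕ c) (P *ℕ (i C suc s) *ℕ c)) ⟩
        - negPow s (fromℕ (P *ℕ (i C s) *ℕ c) + fromℕ (P *ℕ (i C suc s) *ℕ c))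
      ≡⟨ trans (cong -_ (negPow-+ s _ _)) (neg-+ _ _) ⟩
        - term r i j s + term r i (suc j) (suc s)
      ∎
      where
      open ≡-Reasoning
      P = (q ∸ 1) ^ (j ∸ s)
      c = r C (j ∸ s)
      distribute : ∀ P a b c → P *ℕ (a +ℕ b) *ℕ c ≡ P *ℕ a *ℕ c +ℕ P *ℕ b *ℕ c
      distribute = solve-∀

    -- K^{(n+1)}_{j+1}(i) = K^{(n)}_{j+1}(i) + (q-1) K^{(n)}_j(i)   for i ≤ n.
    -- Since i ≤ n, the length n+1-i is suc (n-i), so Pascal's rule in r applies termwise.
    K-step-length : ∀ n j i → i ≤ n → K q (suc n) (suc j) i ≡ K q n (suc j) i + fromℕ (q ∸ 1) * K q n j i
    K-step-length n j i i≤n rewrite ℕP.+-∸-assoc 1 i≤n = begin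
        sumTo j (term (suc r) i (suc j)) + term (suc r) i (suc j) (suc j)
      ≡⟨ cong₂ _+_ (sumTo-cong j (λ t t≤j → term-pascal-r r i j t t≤j)) refl ⟩
        sumTo j (λ t → term r i (suc j) t + fromℕ (q ∸ 1) * term r i j t) + term (suc r) i (suc j) (suc j)
      ≡⟨ cong₂ _+_ (trans (sumTo-+ j (term r i (suc j)) (λ t → fromℕ (q ∸ 1) * term r i j t))
                          (cong (sumTo j (term r i (suc j)) +_) (sumTo-*ˡ j (fromℕ (q ∸ 1)) (term r i j))))
                   (top-term r) ⟩
        (sumTo j (term r i (suc j)) + fromℕ (q ∸ 1) * sumTo j (term r i j)) + term r i (suc j) (suc j)
      ≡⟨ solve 3 (λ a b c → ((a ⊕ b) ⊕ c) ⊜ ((a ⊕ c) ⊕ b)) refl _ _ _ ⟩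
        (sumTo j (term r i (suc j)) + term r i (suc j) (suc j)) + fromℕ (q ∸ 1) * sumTo j (term r i j)
      ∎
      where
      open ≡-Reasoning
      r = n ∸ i
      -- The top term involves C(r, 0) only, so it does not see r.
      top-term : ∀ r → term (suc r) i (suc j) (suc j) ≡ term r i (suc j) (suc j)
      top-term r rewrite ℕP.n∸n≡0 j = refl

    K-step-position : ∀ n j i → K q (suc n) (suc j) (suc i) ≡ K q n (suc j) i - K q n j i
    K-step-position n j i = begin
        sumTo (suc j) (term r (suc i) (suc j))
      ≡⟨ sumTo-peel j _ ⟩
        term r i (suc j) 0 + sumTo j (λ s → term r (suc i) (suc j) (suc s))
      ≡⟨ cong (term r i (suc j) 0 +_) (trans (sumTo-cong j (λ s _ → term-pascal-i r i j s)) (sumTo-+ j _ _)) ⟩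
        term r i (suc j) 0 + (sumTo j (λ s → - term r i j s) + sumTo j (λ s → term r i (suc j) (suc s)))
      ≡⟨ cong (λ z → term r i (suc j) 0 + (z + sumTo j (λ s → term r i (suc j) (suc s)))) (sumTo-neg j _) ⟩
        term r i (suc j) 0 + (- sumTo j (term r i j) + sumTo j (λ s → term r i (suc j) (suc s)))
      ≡⟨ solve 3 (λ a b c → (a ⊕ (b ⊕ c)) ⊜ ((a ⊕ c) ⊕ b)) refl _ _ _ ⟩
        (term r i (suc j) 0 + sumTo j (λ s → term r i (suc j) (suc s))) - sumTo j (term r i j)
      ≡⟨ cong (_- sumTo j (term r i j)) (sym (sumTo-peel j _)) ⟩
        sumTo (suc j) (term r i (suc j)) - sumTo j (term r i j)
      ∎
      where
      open ≡-Reasoning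
      r = n ∸ i

    K-degree-zero : ∀ n i → K q n 0 i ≡ 1ℝ
    K-degree-zero n i = fromℕ-1

    K-vanish : ∀ n j i → n < j → i ≤ n → K q n j i ≡ 0ℝ
    K-vanish n j i n<j i≤n = sumTo-zero j term-zero
      where
      term-zero : ∀ t → t ≤ j → term (n ∸ i) i j t ≡ 0ℝ
      term-zero t _ with t ℕP.≤? i
      ... | yes t≤i rewrite k>n⇒nCk≡0 {n ∸ i} {j ∸ t} (ℕP.<-≤-trans (ℕP.∸-monoˡ-< n<j i≤n) (ℕP.∸-monoʳ-≤ j t≤i))
            | ℕP.*-zeroʳ ((q ∸ 1) ^ (j ∸ t) *ℕ (i C t)) = negPow-0 t
      ... | no t≰i rewrite k>n⇒nCk≡0 {i} {t} (ℕP.≰⇒> t≰i)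
            | ℕP.*-zeroʳ ((q ∸ 1) ^ (j ∸ t)) = negPow-0 t

    -- KMoment n i m = Σ_{j ≤ n} C(n-j, m) K_j(i), which equals q^k C(n-i,k) when k + m = n.
    KMoment : ℕ → ℕ → ℕ → ℝ
    KMoment n i m = sumTo n (λ j → fromℕ ((n ∸ j) C m) * K q n j i)

    KMoment⁺ : ℕ → ℕ → ℕ → ℝ
    KMoment⁺ n i m = sumTo (suc n) (λ j → fromℕ ((suc n ∸ j) C m) * K q n j i)

    KMoment-step-length : ∀ n i m → i ≤ n → KMoment (suc n) i m ≡ KMoment⁺ n i m + fromℕ (q ∸ 1) * KMoment n i m
    KMoment-step-length n i m i≤n = begin
        KMoment (suc n) i m
      ≡⟨ sumTo-peel n _ ⟩
        c₀ + sumTo n (λ j → w j * K q (suc n) (suc j) i)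
      ≡⟨ cong (c₀ +_) (sumTo-cong n (λ j _ → trans (cong (w j *_) (K-step-length n j i i≤n))
                        (solve 4 (λ c a Q b → (c ⊗ (a ⊕ Q ⊗ b)) ⊜ (c ⊗ a ⊕ Q ⊗ (c ⊗ b))) refl _ _ _ _))) ⟩
        c₀ + sumTo n (λ j → w j * K q n (suc j) i + fromℕ (q ∸ 1) * (w j * K q n j i))
      ≡⟨ cong (c₀ +_) (trans (sumTo-+ n (λ j → w j * K q n (suc j) i) (λ j → fromℕ (q ∸ 1) * (w j * K q n j i)))
                             (cong (sumTo n (λ j → w j * K q n (suc j) i) +_) (sumTo-*ˡ n (fromℕ (q ∸ 1)) (λ j → w j * K q n j i)))) ⟩
        c₀ + (sumTo n (λ j → w j * K q n (suc j) i) + fromℕ (q ∸ 1) * KMoment n i m)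
      ≡⟨ sym (+-assoc c₀ _ _) ⟩
        (c₀ + sumTo n (λ j → w j * K q n (suc j) i)) + fromℕ (q ∸ 1) * KMoment n i m
      ≡⟨ cong (_+ fromℕ (q ∸ 1) * KMoment n i m) (sym (sumTo-peel n _)) ⟩
        KMoment⁺ n i m + fromℕ (q ∸ 1) * KMoment n i m
      ∎
      where
      open ≡-Reasoning
      w : ℕ → ℝ
      w j = fromℕ ((n ∸ j) C m)
      c₀ = fromℕ (suc n C m) * K q n 0 i

    KMoment-step-position : ∀ n i m → KMoment (suc n) (suc i) m ≡ KMoment⁺ n i m - KMoment n i m
    KMoment-step-position n i m = begin
        KMoment (suc n) (suc i) m
      ≡⟨ sumTo-peel n _ ⟩
        c₀ + sumTo n (λ j → w j * K q (suc n) (suc j) (suc i))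
      ≡⟨ cong (c₀ +_) (sumTo-cong n (λ j _ → trans (cong (w j *_) (K-step-position n j i))
                        (*-distribˡ-sub _ _ _))) ⟩
        c₀ + sumTo n (λ j → w j * K q n (suc j) i - w j * K q n j i)
      ≡⟨ cong (c₀ +_) (trans (sumTo-+ n (λ j → w j * K q n (suc j) i) (λ j → - (w j * K q n j i)))
                             (cong (sumTo n (λ j → w j * K q n (suc j) i) +_) (sumTo-neg n (λ j → w j * K q n j i)))) ⟩
        c₀ + (sumTo n (λ j → w j * K q n (suc j) i) - KMoment n i m)
      ≡⟨ sym (+-assoc c₀ _ _) ⟩
        (c₀ + sumTo n (λ j → w j * K q n (suc j) i)) - KMoment n i m
      ≡⟨ cong (_- KMoment n i m) (sym (sumTo-peel n _)) ⟩
        KMoment⁺ n i m - KMoment n i m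
      ∎
      where
      open ≡-Reasoning
      w : ℕ → ℝ
      w j = fromℕ ((n ∸ j) C m)
      c₀ = fromℕ (suc n C m) * K q n 0 i

    -- The extra term of KMoment⁺ involves K_{n+1} = 0.
    KMoment⁺-last : ∀ n i m → i ≤ n → KMoment⁺ n i m ≡ sumTo n (λ j → fromℕ ((suc n ∸ j) C m) * K q n j i)
    KMoment⁺-last n i m i≤n =
      trans (cong (sumTo n (λ j → fromℕ ((suc n ∸ j) C m) * K q n j i) +_)
                  (trans (cong (fromℕ ((suc n ∸ suc n) C m) *_) (K-vanish n (suc n) i ℕP.≤-refl i≤n)) (zeroʳ _)))
            (+-identityʳ _)

    KMoment⁺-zero : ∀ n i → i ≤ n → KMoment⁺ n i 0 ≡ KMoment n i 0
    KMoment⁺-zero n i = KMoment⁺-last n i 0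

    -- Pascal's rule in the weights.
    KMoment⁺-suc : ∀ n i m → i ≤ n → KMoment⁺ n i (suc m) ≡ KMoment n i m + KMoment n i (suc m)
    KMoment⁺-suc n i m i≤n = trans (KMoment⁺-last n i (suc m) i≤n) (trans (sumTo-cong n pascal) (sumTo-+ n _ _))
      where
      pascal : ∀ j → j ≤ n → fromℕ ((suc n ∸ j) C suc m) * K q n j i ≡ fromℕ ((n ∸ j) C m) * K q n j i + fromℕ ((n ∸ j) C suc m) * K q n j i
      pascal j j≤n = trans (cong (λ e → fromℕ (e C suc m) * K q n j i) (ℕP.+-∸-assoc 1 j≤n))
                     (trans (cong (λ e → fromℕ e * K q n j i) (sym (nCk+nC[k+1]≡[n+1]C[k+1] (n ∸ j) m)))
                     (trans (cong (_* K q n j i) (fromℕ-+ ((n ∸ j) C m) ((n ∸ j) C suc m))) (distribʳ _ _ _)))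

    KMoment-vanish : ∀ n i m → n < m → KMoment n i m ≡ 0ℝ
    KMoment-vanish n i m n<m = sumTo-zero n (λ j _ → trans (cong (λ e → fromℕ e * K q n j i) (k>n⇒nCk≡0 (ℕP.≤-<-trans (ℕP.m∸n≤m n j) n<m))) (zeroˡ _))

    transform : ℕ → (ℕ → ℝ) → ℕ → ℝ
    transform n x j = sumTo n (λ i → x i * K q n j i)

    transform-*ˡ : ∀ n c (x : ℕ → ℝ) j → transform n (λ i → c * x i) j ≡ c * transform n x j
    transform-*ˡ n c x j = trans (sumTo-cong n (λ i _ → *-assoc _ _ _)) (sumTo-*ˡ n c _)

    module _ (1≤q : 1 ≤ q) where

      absorb : ∀ w → w + fromℕ (q ∸ 1) * w ≡ fromℕ q * w
      absorb w = trans (1+-distribʳ (fromℕ (q ∸ 1)) w) (cong (_* w) (sym (fromℕ-pred q 1≤q)))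

      KMoment-origin-zero : ∀ n → KMoment (suc n) 0 0 ≡ fromℕ q * KMoment n 0 0
      KMoment-origin-zero n = trans (KMoment-step-length n 0 0 z≤n) (trans (cong (_+ fromℕ (q ∸ 1) * KMoment n 0 0) (KMoment⁺-zero n 0 z≤n)) (absorb (KMoment n 0 0)))

      KMoment-origin-suc : ∀ n m → KMoment (suc n) 0 (suc m) ≡ KMoment n 0 m + fromℕ q * KMoment n 0 (suc m)
      KMoment-origin-suc n m =
        trans (KMoment-step-length n 0 (suc m) z≤n)
              (trans (cong (_+ fromℕ (q ∸ 1) * KMoment n 0 (suc m)) (KMoment⁺-suc n 0 m z≤n))
                     (trans (+-assoc (KMoment n 0 m) (KMoment n 0 (suc m)) (fromℕ (q ∸ 1) * KMoment n 0 (suc m)))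
                            (cong (KMoment n 0 m +_) (absorb (KMoment n 0 (suc m))))))

      KMoment-shift-zero : ∀ n i → i ≤ n → KMoment (suc n) (suc i) 0 ≡ 0ℝ
      KMoment-shift-zero n i i≤n = trans (KMoment-step-position n i 0) (trans (cong (_- KMoment n i 0) (KMoment⁺-zero n i i≤n)) (-‿inverseʳ (KMoment n i 0)))

      KMoment-shift-suc : ∀ n i m → i ≤ n → KMoment (suc n) (suc i) (suc m) ≡ KMoment n i m
      KMoment-shift-suc n i m i≤n =
        trans (KMoment-step-position n i (suc m))
              (trans (cong (_- KMoment n i (suc m)) (KMoment⁺-suc n i m i≤n)) (//-rightDividesʳ (KMoment n i (suc m)) (KMoment n i m)))

      KMoment-closed : ∀ m k i → i ≤ m +ℕ k → KMoment (m +ℕ k) i m ≡ fromℕ (q ^ k) * fromℕ ((m +ℕ k ∸ i) C k)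
      KMoment-closed zero zero zero _ = refl
      KMoment-closed zero (suc k) (suc i) (s≤s i≤k) = begin
          KMoment (suc k) (suc i) 0                    ≡⟨ KMoment-shift-zero k i i≤k ⟩
          0ℝ                                           ≡⟨ sym (zeroʳ _) ⟩
          fromℕ (q ^ suc k) * fromℕ 0                  ≡⟨ cong (λ e → fromℕ (q ^ suc k) * fromℕ e) (sym (k>n⇒nCk≡0 (s≤s (ℕP.m∸n≤m k i)))) ⟩
          fromℕ (q ^ suc k) * fromℕ ((k ∸ i) C suc k)  ∎
        where open ≡-Reasoning
      KMoment-closed (suc m) k (suc i) (s≤s i≤) = trans (KMoment-shift-suc (m +ℕ k) i m i≤) (KMoment-closed m k i i≤)
      KMoment-closed zero (suc k) zero _ = begin
          KMoment (suc k) 0 0                                 ≡⟨ KMoment-origin-zero k ⟩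
          fromℕ q * KMoment k 0 0                             ≡⟨ cong (fromℕ q *_) (KMoment-closed zero k 0 z≤n) ⟩
          fromℕ q * (fromℕ (q ^ k) * fromℕ (k C k))           ≡⟨ sym (*-assoc _ _ _) ⟩
          (fromℕ q * fromℕ (q ^ k)) * fromℕ (k C k)           ≡⟨ cong₂ _*_ (sym (fromℕ-* q (q ^ k))) (cong fromℕ (trans (nCn≡1 k) (sym (nCn≡1 (suc k))))) ⟩
          fromℕ (q ^ suc k) * fromℕ (suc k C suc k)           ∎
        where open ≡-Reasoning
      KMoment-closed (suc m) zero zero _ = begin
          KMoment (suc (m +ℕ 0)) 0 (suc m)                    ≡⟨ KMoment-origin-suc (m +ℕ 0) m ⟩
          KMoment (m +ℕ 0) 0 m + fromℕ q * KMoment (m +ℕ 0) 0 (suc m)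
            ≡⟨ cong₂ (λ a b → a + fromℕ q * b) (KMoment-closed m zero 0 z≤n) (KMoment-vanish (m +ℕ 0) 0 (suc m) (s≤s (ℕP.≤-reflexive (ℕP.+-identityʳ m)))) ⟩
          fromℕ 1 * fromℕ 1 + fromℕ q * 0ℝ                    ≡⟨ trans (cong (fromℕ 1 * fromℕ 1 +_) (zeroʳ (fromℕ q))) (+-identityʳ _) ⟩
          fromℕ 1 * fromℕ 1                                   ∎
        where open ≡-Reasoning
      KMoment-closed (suc m) (suc k) zero _ = begin
          KMoment (suc N) 0 (suc m)                           ≡⟨ KMoment-origin-suc N m ⟩
          KMoment N 0 m + fromℕ q * KMoment N 0 (suc m)       ≡⟨ cong₂ (λ a b → a + fromℕ q * b) (KMoment-closed m (suc k) 0 z≤n) shifted ⟩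
          fromℕ (q ^ suc k) * fromℕ (N C suc k) + fromℕ q * (fromℕ (q ^ k) * fromℕ (N C k))
            ≡⟨ powers-pascal ⟩
          fromℕ (q ^ suc k) * fromℕ (suc N C suc k)           ∎
        where
        open ≡-Reasoning
        N = m +ℕ suc k
        shifted : KMoment N 0 (suc m) ≡ fromℕ (q ^ k) * fromℕ (N C k)
        shifted = subst (λ L → KMoment L 0 (suc m) ≡ fromℕ (q ^ k) * fromℕ (L C k)) (sym (ℕP.+-suc m k))
                        (KMoment-closed (suc m) k 0 z≤n)
        powers-pascal : fromℕ (q ^ suc k) * fromℕ (N C suc k) + fromℕ q * (fromℕ (q ^ k) * fromℕ (N C k))
                      ≡ fromℕ (q ^ suc k) * fromℕ (suc N C suc k)
        powers-pascal = begin
            fromℕ (q ^ suc k) * fromℕ (N C suc k) + fromℕ q * (fromℕ (q ^ k) * fromℕ (N C k))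
          ≡⟨ cong (fromℕ (q ^ suc k) * fromℕ (N C suc k) +_)
                  (trans (sym (*-assoc (fromℕ q) (fromℕ (q ^ k)) (fromℕ (N C k)))) (cong (_* fromℕ (N C k)) (sym (fromℕ-* q (q ^ k))))) ⟩
            fromℕ (q ^ suc k) * fromℕ (N C suc k) + fromℕ (q ^ suc k) * fromℕ (N C k)
          ≡⟨ trans (sym (distribˡ (fromℕ (q ^ suc k)) (fromℕ (N C suc k)) (fromℕ (N C k))))
                   (cong (fromℕ (q ^ suc k) *_) (+-comm (fromℕ (N C suc k)) (fromℕ (N C k)))) ⟩
            fromℕ (q ^ suc k) * (fromℕ (N C k) + fromℕ (N C suc k))
          ≡⟨ cong (_ *_) (trans (sym (fromℕ-+ (N C k) (N C suc k))) (cong fromℕ (nCk+nC[k+1]≡[n+1]C[k+1] N k))) ⟩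
            fromℕ (q ^ suc k) * fromℕ (suc N C suc k)
          ∎

      KMoment-complement : ∀ n k i → k ≤ n → i ≤ n → KMoment n i (n ∸ k) ≡ fromℕ (q ^ k) * binom n k i
      KMoment-complement n k i k≤n i≤n =
        subst (λ N → KMoment N i (n ∸ k) ≡ fromℕ (q ^ k) * fromℕ ((N ∸ i) C k)) (ℕP.m∸n+n≡m k≤n)
              (KMoment-closed (n ∸ k) k i (subst (i ≤_) (sym (ℕP.m∸n+n≡m k≤n)) i≤n))

      moment-transform : ∀ n k (x : ℕ → ℝ) → k ≤ n → moment n (n ∸ k) (transform n x) ≡ fromℕ (q ^ k) * moment n k x
      moment-transform n k x k≤n = begin
          sumTo n (λ j → binom n (n ∸ k) j * sumTo n (λ i → x i * K q n j i))
        ≡⟨ sumTo-cong n (λ j _ → sym (sumTo-*ˡ n _ _)) ⟩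
          sumTo n (λ j → sumTo n (λ i → binom n (n ∸ k) j * (x i * K q n j i)))
        ≡⟨ sumTo-swap n n _ ⟩
          sumTo n (λ i → sumTo n (λ j → binom n (n ∸ k) j * (x i * K q n j i)))
        ≡⟨ sumTo-cong n (λ i _ → trans (sumTo-cong n (λ j _ → solve 3 (λ b y c → (b ⊗ (y ⊗ c)) ⊜ (y ⊗ (b ⊗ c))) refl _ (x i) _)) (sumTo-*ˡ n (x i) _)) ⟩
          sumTo n (λ i → x i * KMoment n i (n ∸ k))
        ≡⟨ sumTo-cong n (λ i i≤n → cong (x i *_) (KMoment-complement n k i k≤n i≤n)) ⟩
          sumTo n (λ i → x i * (fromℕ (q ^ k) * binom n k i))
        ≡⟨ sumTo-cong n (λ i _ → solve 3 (λ y c b → (y ⊗ (c ⊗ b)) ⊜ (c ⊗ (b ⊗ y))) refl (x i) _ _) ⟩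
          sumTo n (λ i → fromℕ (q ^ k) * (binom n k i * x i))
        ≡⟨ sumTo-*ˡ n _ _ ⟩
          fromℕ (q ^ k) * moment n k x
        ∎
        where open ≡-Reasoning

      moment-transform′ : ∀ n k (x : ℕ → ℝ) → k ≤ n → moment n k (transform n x) ≡ fromℕ (q ^ (n ∸ k)) * moment n (n ∸ k) x
      moment-transform′ n k x k≤n =
        subst (λ m → moment n m (transform n x) ≡ fromℕ (q ^ (n ∸ k)) * moment n (n ∸ k) x) (ℕP.m∸[m∸n]≡n k≤n) (moment-transform n (n ∸ k) x (ℕP.m∸n≤m n k))

      transform-involutive : ∀ n (x : ℕ → ℝ) j → j ≤ n → transform n (transform n x) j ≡ fromℕ (q ^ n) * x j
      transform-involutive n x = moments-determine n _ _ same-moments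
        where
        same-moments : ∀ m → m ≤ n → moment n m (transform n (transform n x)) ≡ moment n m (λ i → fromℕ (q ^ n) * x i)
        same-moments m m≤n = begin
            moment n m (transform n (transform n x))
          ≡⟨ moment-transform′ n m (transform n x) m≤n ⟩
            fromℕ (q ^ (n ∸ m)) * moment n (n ∸ m) (transform n x)
          ≡⟨ cong (fromℕ (q ^ (n ∸ m)) *_) (moment-transform n m x m≤n) ⟩
            fromℕ (q ^ (n ∸ m)) * (fromℕ (q ^ m) * moment n m x)
          ≡⟨ sym (*-assoc _ _ _) ⟩
            (fromℕ (q ^ (n ∸ m)) * fromℕ (q ^ m)) * moment n m x
          ≡⟨ cong (_* moment n m x) (trans (sym (fromℕ-* (q ^ (n ∸ m)) (q ^ m)))
               (cong fromℕ (trans (sym (ℕP.^-distribˡ-+-* q (n ∸ m) m)) (cong (q ^_) (ℕP.m∸n+n≡m m≤n))))) ⟩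
            fromℕ (q ^ n) * moment n m x
          ≡⟨ sym (moment-*ˡ n m _ x) ⟩
            moment n m (λ i → fromℕ (q ^ n) * x i)
          ∎
          where open ≡-Reasoning

      sum-transform : ∀ n (x : ℕ → ℝ) → sumTo n (transform n x) ≡ fromℕ (q ^ n) * x 0
      sum-transform n x = begin
          sumTo n (transform n x)                     ≡⟨ sym (moment-0 n _) ⟩
          moment n 0 (transform n x)                  ≡⟨ cong (λ e → moment n e (transform n x)) (sym (ℕP.n∸n≡0 n)) ⟩
          moment n (n ∸ n) (transform n x)            ≡⟨ moment-transform n n x ℕP.≤-refl ⟩
          fromℕ (q ^ n) * moment n n x                ≡⟨ cong (fromℕ (q ^ n) *_) (moment-top n x) ⟩
          fromℕ (q ^ n) * x 0                         ∎
        where open ≡-Reasoning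

  module Duality (q : ℕ) (1≤q : 1 ≤ q) (n : ℕ) where
    open Krawtchouk q

    Qⁿ : ℝ
    Qⁿ = fromℕ (q ^ n)

    Qⁿ≢0 : ¬ (Qⁿ ≡ 0ℝ)
    Qⁿ≢0 = fromℕ-≢0 (q ^ n) (ℕP.m^n>0 q {{>-nonZero 1≤q}} n)

    1≤size : ∀ {b} → IsQuasicode q n b → 1ℝ ≤ᵣ size n b
    1≤size qb = 1≤sumTo n (IsQuasicode.a0≡1 qb) (IsQuasicode.nonneg qb)

    size≢0 : ∀ {b} → IsQuasicode q n b → ¬ (size n b ≡ 0ℝ)
    size≢0 qb = 1≤⇒≢0 (1≤size qb)

    0≤size⁻¹ : ∀ {b} → IsQuasicode q n b → 0ℝ ≤ᵣ size n b ⁻¹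
    0≤size⁻¹ {b} qb = ⁻¹-nonneg (size n b) (1≤⇒0≤ (1≤size qb)) (size≢0 qb)

    transform-dual : ∀ {b} → IsQuasicode q n b → ∀ j → j ≤ n → transform n (dual q n b) j ≡ size n b ⁻¹ * (Qⁿ * b j)
    transform-dual {b} qb j j≤n = trans (transform-*ˡ n _ (transform n b) j) (cong (size n b ⁻¹ *_) (transform-involutive 1≤q n b j j≤n))

    dual-isQuasicode : ∀ {b} → IsQuasicode q n b → IsQuasicode q n (dual q n b)
    dual-isQuasicode {b} qb = record
      { a0≡1 = trans (cong (size n b ⁻¹ *_) (sumTo-cong n (λ i _ → trans (cong (b i *_) (K-degree-zero n i)) (*-identityʳ _))))
                     (⁻¹-inverseˡ (size n b) (size≢0 qb))
      ; nonneg = λ i i≤n → *-nonneg (0≤size⁻¹ qb) (IsQuasicode.dualNonneg qb i i≤n)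
      ; dualNonneg = λ j j≤n → ≤-respʳ-≈ (sym (transform-dual qb j j≤n))
                                         (*-nonneg (0≤size⁻¹ qb) (*-nonneg (fromℕ-nonneg (q ^ n)) (IsQuasicode.nonneg qb j j≤n)))
      }

    size-dual : ∀ {b} → IsQuasicode q n b → size n (dual q n b) ≡ size n b ⁻¹ * Qⁿ
    size-dual {b} qb = trans (sumTo-*ˡ n _ (transform n b))
                             (cong (size n b ⁻¹ *_) (trans (sum-transform 1≤q n b) (trans (cong (Qⁿ *_) (IsQuasicode.a0≡1 qb)) (*-identityʳ _))))

    dual-dual : ∀ {b} → IsQuasicode q n b → ∀ j → j ≤ n → dual q n (dual q n b) j ≡ b j
    dual-dual {b} qb j j≤n = begin
        size n (dual q n b) ⁻¹ * transform n (dual q n b) j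
      ≡⟨ cong₂ (λ s t → s ⁻¹ * t) (size-dual qb) (transform-dual qb j j≤n) ⟩
        (size n b ⁻¹ * Qⁿ) ⁻¹ * (size n b ⁻¹ * (Qⁿ * b j))
      ≡⟨ cong ((size n b ⁻¹ * Qⁿ) ⁻¹ *_) (sym (*-assoc (size n b ⁻¹) Qⁿ (b j))) ⟩
        (size n b ⁻¹ * Qⁿ) ⁻¹ * ((size n b ⁻¹ * Qⁿ) * b j)
      ≡⟨ ⁻¹-cancelˡ _ (b j) (*-≢0 _ _ (⁻¹-≢0 _ (size≢0 qb)) Qⁿ≢0) ⟩
        b j
      ∎
      where open ≡-Reasoning

    moment-dual : ∀ {b} k → k ≤ n → moment n k (dual q n b) ≡ size n b ⁻¹ * (fromℕ (q ^ (n ∸ k)) * moment n (n ∸ k) b)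
    moment-dual {b} k k≤n = trans (moment-*ˡ n k _ (transform n b)) (cong (size n b ⁻¹ *_) (moment-transform′ 1≤q n k b k≤n))

    size-dual-of-dual-size : ∀ {a b} → IsQuasicode q n a → IsQuasicode q n b → size n b ≡ size n (dual q n a) → size n (dual q n b) ≡ size n a
    size-dual-of-dual-size {a} {b} qa qb |b|≡|a⊥| = begin
        size n (dual q n b)                  ≡⟨ size-dual qb ⟩
        size n b ⁻¹ * Qⁿ                     ≡⟨ cong (λ s → s ⁻¹ * Qⁿ) |b|≡|a⊥| ⟩
        size n (dual q n a) ⁻¹ * Qⁿ          ≡⟨ sym (size-dual (dual-isQuasicode qa)) ⟩
        size n (dual q n (dual q n a))       ≡⟨ sumTo-cong n (dual-dual qa) ⟩
        size n a                             ∎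
      where open ≡-Reasoning

    MomentOptimal : (ℕ → ℝ) → Set
    MomentOptimal a = ∀ b → IsQuasicode q n b → size n b ≡ size n a → ∀ k → k ≤ n → moment n k a ≤ᵣ moment n k b

    -- Universal optimality tested on the completely monotonic basis functions.
    universallyOptimal⇒momentOptimal : ∀ {a} → UniversallyOptimal q n a → MomentOptimal a
    universallyOptimal⇒momentOptimal uo b qb |b|≡|a| k k≤n = proj₂ uo (binom n k) (binom-completelyMonotonic n k) b qb |b|≡|a|

    -- Conversely, any pairing with a completely monotonic f is a nonnegative combination of moments.
    momentOptimal⇒universallyOptimal : ∀ {a} → IsQuasicode q n a → MomentOptimal a → UniversallyOptimal q n a
    momentOptimal⇒universallyOptimal {a} qa opt = qa , λ f cm b qb |b|≡|a| → begin
        sumTo n (λ i → f i * a i)                              ≡⟨ pairing-via-moments n f a ⟩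
        sumTo n (λ k → newtonCoeff n f k * moment n k a)       ≤⟨ sumTo-mono n (λ k k≤n → *-monoˡ-≤ (cm k (n ∸ k) (ℕP.≤-reflexive (ℕP.m∸n+n≡m k≤n))) (opt b qb |b|≡|a| k k≤n)) ⟩
        sumTo n (λ k → newtonCoeff n f k * moment n k b)       ≡⟨ sym (pairing-via-moments n f b) ⟩
        sumTo n (λ i → f i * b i)                              ∎
      where open ≤ᵣ-Reasoning

    momentOptimal-resp : ∀ {a a′} → (∀ i → i ≤ n → a i ≡ a′ i) → MomentOptimal a → MomentOptimal a′
    momentOptimal-resp a≗a′ opt b qb |b|≡|a′| k k≤n =
      ≤-respˡ-≈ (sumTo-cong n (λ i i≤n → cong (binom n k i *_) (a≗a′ i i≤n)))
                (opt b qb (trans |b|≡|a′| (sym (sumTo-cong n a≗a′))) k k≤n)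

    -- The key step: duality transports moment-optimality.  For b of size |a^⊥|,
    -- S_k(a^⊥) = |a|⁻¹ q^(n-k) S_{n-k}(a) ≤ |a|⁻¹ q^(n-k) S_{n-k}(b^⊥) = S_k(b^⊥⊥) = S_k(b).
    dual-momentOptimal : ∀ {a} → IsQuasicode q n a → MomentOptimal a → MomentOptimal (dual q n a)
    dual-momentOptimal {a} qa opt b qb |b|≡|a⊥| k k≤n = begin
        moment n k (dual q n a)                                               ≡⟨ moment-dual k k≤n ⟩
        size n a ⁻¹ * (fromℕ (q ^ (n ∸ k)) * moment n (n ∸ k) a)              ≤⟨ *-monoˡ-≤ (0≤size⁻¹ qa) (*-monoˡ-≤ (fromℕ-nonneg (q ^ (n ∸ k))) dual-comparison) ⟩
        size n a ⁻¹ * (fromℕ (q ^ (n ∸ k)) * moment n (n ∸ k) (dual q n b))   ≡⟨ cong (λ s → s ⁻¹ * _) (sym |b⊥|≡|a|) ⟩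
        size n (dual q n b) ⁻¹ * (fromℕ (q ^ (n ∸ k)) * moment n (n ∸ k) (dual q n b)) ≡⟨ sym (moment-dual k k≤n) ⟩
        moment n k (dual q n (dual q n b))                                    ≡⟨ sumTo-cong n (λ i i≤n → cong (binom n k i *_) (dual-dual qb i i≤n)) ⟩
        moment n k b                                                          ∎
      where
      open ≤ᵣ-Reasoning
      |b⊥|≡|a| : size n (dual q n b) ≡ size n a
      |b⊥|≡|a| = size-dual-of-dual-size qa qb |b|≡|a⊥|
      dual-comparison : moment n (n ∸ k) a ≤ᵣ moment n (n ∸ k) (dual q n b)
      dual-comparison = opt (dual q n b) (dual-isQuasicode qb) |b⊥|≡|a| (n ∸ k) (ℕP.m∸n≤m n k)

    dual-preserves-optimality : ∀ {a} → IsQuasicode q n a → UniversallyOptimal q n a → UniversallyOptimal q n (dual q n a)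
    dual-preserves-optimality qa uo =
      momentOptimal⇒universallyOptimal (dual-isQuasicode qa) (dual-momentOptimal qa (universallyOptimal⇒momentOptimal uo))

    -- Apply the forward direction to a^⊥ and use a^⊥⊥ = a.
    dual-reflects-optimality : ∀ {a} → IsQuasicode q n a → UniversallyOptimal q n (dual q n a) → UniversallyOptimal q n a
    dual-reflects-optimality qa uo⊥ =
      momentOptimal⇒universallyOptimal qa
        (momentOptimal-resp (dual-dual qa) (dual-momentOptimal (dual-isQuasicode qa) (universallyOptimal⇒momentOptimal uo⊥)))

proposition3p4 : (R : RealField) → (q n : ℕ) → 2 ≤ q → 1 ≤ n →
    (a : ℕ → RealField.ℝ R) → Quasi.IsQuasicode R q n a →
    (Quasi.UniversallyOptimal R q n a ⇔ Quasi.UniversallyOptimal R q n (Quasi.dual R q n a))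
proposition3p4 R q n 2≤q _ a qa = mk⇔ (dual-preserves-optimality qa) (dual-reflects-optimality qa)
  where open QuasicodeDuality.Duality R q (ℕP.≤-trans (s≤s z≤n) 2≤q) n
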